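{- Let $A$ be a $d$-dimensional block permutation of order $4$ equivalent to $\mathcal{M}_4^d$, with parameters $(\mathcal{E},\lambda,s)$, $\mathcal{E}=(\varepsilon_1,\dots,\varepsilon_d)$, such that exactly $k$ of the $\varepsilon_i$ equal $2$. Consider the filled subcubes of $\mathcal{M}_4^d$ with respect to the parameters $((2,\dots,2),\lambda_M,0)$, i.e. the sets $C_y=\{\alpha:\alpha_i\in\{0,2\}\text{ if }y_i=0,\ \alpha_i\in\{1,3\}\text{ if }y_i=1\}$ with $y_1+\dots+y_d$ even. (1) If $0\le k<d$, then every filled subcube of $\mathcal{M}_4^d$ intersects $2^{d-k-1}$ filled subcubes of $A$, the intersections being $k$-dimensional submatrices of order $2$. (2) If $k=d$ and $s=0$, the filled subcubes of $A$ coincide with those of $\mathcal{M}_4^d$; if $k=d$ and $s=1$, no filled subcube of $A$ intersects a filled subcube of $\mathcal{M}_4^d$.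
   Context: Matrices are arrays indexed by $\{0,1,2,3\}^d$; two matrices are equivalent if one is obtained from the other by permuting coordinate positions and applying permutations of $\{0,1,2,3\}$ to individual coordinates. $\mathcal{M}_4^d$: entry $1$ iff $\sum\alpha_i\equiv0\pmod4$. Define $p_1$: $0,1\mapsto0$, $2,3\mapsto1$; $p_2$: $0,2\mapsto0$, $1,3\mapsto1$; $p_3$: $0,3\mapsto0$, $1,2\mapsto1$; $\mu_1$: $0,2\mapsto0$, $1,3\mapsto1$; $\mu_2$: $0,1\mapsto0$, $2,3\mapsto1$; $\mu_3$: $0,2\mapsto0$, $1,3\mapsto1$. $Q_s^d=\{y\in\{0,1\}^d:\sum y_i\equiv s\pmod 2\}$. A $(0,1)$-matrix $A$ is a block permutation with parameters $(\mathcal{E},\lambda,s)$ ($\mathcal{E}\in\{1,2,3\}^d$, $s\in\{0,1\}$, $\lambda:Q_s^d\to\{0,1\}$) if $a_\alpha=1$ exactly when $\bigoplus_i p_{\varepsilon_i}(\alpha_i)=s$ and $\bigoplus_i\mu_{\varepsilon_i}(\alpha_i)\oplus\lambda(p_{\varepsilon_1}(\alpha_1),\dots,p_{\varepsilon_d}(\alpha_d))=0$. Its subcubes are $C'_y=\{\alpha:p_{\varepsilon_i}(\alpha_i)=y_i\ \forall i\}$, and $C'_y$ is filled iff $y\in Q_s^d$. $\lambda_M(x)=0$ if $\sum x_i\equiv0\pmod4$, $1$ if $\sum x_i\equiv 2\pmod 4$. A $k$-dimensional submatrix of order $2$ is a set $T_1\times\dots\times T_d$ with exactly $k$ of the $T_i$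 of size $2$ and the others of size $1$. -}

module Defs where

open import Data.Bool using (Bool; true; false; _xor_)
open import Data.Nat using (ℕ; zero; suc; _%_; _≡ᵇ_)
open import Data.Fin using (Fin; toℕ) renaming (zero to f0; suc to fs)
open import Data.Fin.Subset using (Subset; ∣_∣; _∈_)
open import Data.Fin.Permutation using (Permutation′; _⟨$⟩ʳ_)
open import Data.Vec using (Vec; []; _∷_; lookup; tabulate; map; sum; zipWith)
open import Data.Product using (Σ; _×_)
open import Data.Sum using (_⊎_)
open import Function.Bundles using (_⇔_)
open import Relation.Binary.PropositionalEquality using (_≡_)

-- Indices α ∈ {0,1,2,3}^d are vectors Vec (Fin 4) d; (0,1)-matrices are maps to Bool
-- (true = 1, false = 0).
Index : ℕ → Set
Index d = Vec (Fin 4) d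

Matrix : ℕ → Set
Matrix d = Index d → Bool

M4 : (d : ℕ) → Matrix d
M4 d α = (sum (map toℕ α) % 4) ≡ᵇ 0

Equivalent : {d : ℕ} → Matrix d → Matrix d → Set
Equivalent {d} A B =
  Σ (Permutation′ d) λ σ → Σ (Fin d → Permutation′ 4) λ π →
    ∀ (α : Index d) → A α ≡ B (tabulate λ i → π i ⟨$⟩ʳ lookup α (σ ⟨$⟩ʳ i))

data Eps : Set where
  e1 e2 e3 : Eps

p : Eps → Fin 4 → Bool
p e1 f0 = false
p e1 (fs f0) = false
p e1 (fs (fs f0)) = true
p e1 (fs (fs (fs f0))) = true
p e2 f0 = false
p e2 (fs f0) = true
p e2 (fs (fs f0)) = false
p e2 (fs (fs (fs f0))) = true
p e3 f0 = false
p e3 (fs f0) = true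
p e3 (fs (fs f0)) = true
p e3 (fs (fs (fs f0))) = false

μ : Eps → Fin 4 → Bool
μ e1 f0 = false
μ e1 (fs f0) = true
μ e1 (fs (fs f0)) = false
μ e1 (fs (fs (fs f0))) = true
μ e2 f0 = false
μ e2 (fs f0) = false
μ e2 (fs (fs f0)) = true
μ e2 (fs (fs (fs f0))) = true
μ e3 f0 = false
μ e3 (fs f0) = true
μ e3 (fs (fs f0)) = false
μ e3 (fs (fs (fs f0))) = true

-- ⊕ of all entries (= sum mod 2); y ∈ Q_s^d iff parity y ≡ s.
parity : {n : ℕ} → Vec Bool n → Bool
parity [] = false
parity (b ∷ v) = b xor parity v

pvec : {d : ℕ} → Vec Eps d → Index d → Vec Bool d
pvec ε α = zipWith p ε α

μvec : {d : ℕ} → Vec Eps d → Index d → Vec Bool d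
μvec ε α = zipWith μ ε α

-- A is a block permutation with parameters (ε, λ, s).  λ is given on all of {0,1}^d,
-- but only its values on Q_s^d are ever used.
IsBlockPerm : {d : ℕ} → Matrix d → Vec Eps d → (Vec Bool d → Bool) → Bool → Set
IsBlockPerm {d} A ε lam s =
  ∀ (α : Index d) →
    (A α ≡ true) ⇔ ((parity (pvec ε α) ≡ s) × ((parity (μvec ε α) xor lam (pvec ε α)) ≡ false))

count2 : {d : ℕ} → Vec Eps d → ℕ
count2 [] = 0
count2 (e2 ∷ ε) = suc (count2 ε)
count2 (e1 ∷ ε) = count2 ε
count2 (e3 ∷ ε) = count2 ε

InC′ : {d : ℕ} → Vec Eps d → Vec Bool d → Index d → Set
InC′ ε y α = pvec ε α ≡ y

InC : {d : ℕ} → Vec Bool d → Index d → Set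
InC y α = map (p e2) α ≡ y

countSize2 : {d : ℕ} → Vec (Subset 4) d → ℕ
countSize2 [] = 0
countSize2 (T ∷ Ts) with ∣ T ∣ ≡ᵇ 2
... | true = suc (countSize2 Ts)
... | false = countSize2 Ts

IsSubmatrix2 : {d : ℕ} → ℕ → (Index d → Set) → Set
IsSubmatrix2 {d} k S =
  Σ (Vec (Subset 4) d) λ T →
    (∀ (i : Fin d) → (∣ lookup T i ∣ ≡ 1) ⊎ (∣ lookup T i ∣ ≡ 2))
    × (countSize2 T ≡ k)
    × (∀ (α : Index d) → S α ⇔ (∀ (i : Fin d) → lookup α i ∈ lookup T i))

module Submission where

-- C′_{y′} ∩ C_y is the product of the sets
-- {a : p_{ε_i} a = y′_i, p_2 a = y_i}.  Where ε_i = 2 this set is {a : p_2 a = y_i} if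
-- y′_i = y_i and empty otherwise; for ε_i ∈ {1,3} the pair (p_{ε_i}, p_2) is a bijection
-- {0,1,2,3} → {0,1}², so it is a single point.  Hence C′_{y′} meets C_y iff y′ agrees with y
-- on the k coordinates with ε_i = 2, the intersection is then a k-dimensional submatrix of
-- order 2, and when k < d exactly half of the 2^(d-k) such y′ have parity s.  When k = d,
-- p_ε = p_2 coordinatewise and C′_y = C_y.

open import Defs
open import Data.Bool using (Bool; true; false; _xor_; _∧_; if_then_else_)
open import Data.Bool.Properties using (xor-assoc; xor-same; T-∧; T-≡) renaming (_≟_ to _≟ᵇ_)
open import Data.Nat using (ℕ; suc; _+_; _<_; _∸_; _^_; pred; >-nonZero)
open import Data.Nat.Properties using (+-comm; +-suc; +-identityʳ; suc-injective; m+n∸m≡n; m+1+n≢m; m<n⇒0<n∸m; suc-pred)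
open import Data.Fin using (Fin) renaming (zero to f0; suc to fs)
open import Data.Fin.Subset using (Subset; ∣_∣) renaming (_∈_ to _∈ₛ_)
open import Data.Vec using (Vec; []; _∷_; lookup; tabulate; map)
open import Data.Vec.Properties using (∷-injectiveˡ; ∷-injectiveʳ; []=⇒lookup; lookup⇒[]=; lookup∘tabulate)
open import Data.List using (List; []; length; _++_; [_]) renaming (map to mapL)
open import Data.List.Properties using (length-map; length-++)
open import Data.List.Membership.Propositional using (_∈_)
open import Data.List.Membership.Propositional.Properties using (∈-map⁺; ∈-map⁻; ∈-++⁺ˡ; ∈-++⁺ʳ; ∈-++⁻)
open import Data.List.Relation.Unary.Any using (here)
open import Data.List.Relation.Unary.Unique.Propositional using (Unique)
import Data.List.Relation.Unary.Unique.Propositional.Properties as Unique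
import Data.List.Relation.Unary.AllPairs as AllPairs
import Data.List.Relation.Unary.All as All
open import Data.List.Relation.Binary.Disjoint.Propositional using (Disjoint)
open import Data.Unit using (⊤; tt)
open import Data.Empty using (⊥-elim)
open import Data.Sum using (_⊎_; inj₁; inj₂)
open import Data.Product using (Σ; _×_; ∃; _,_; proj₁; proj₂)
open import Function.Bundles using (_⇔_; mk⇔; Equivalence)
open import Relation.Nullary using (¬_; Dec)
open import Relation.Nullary.Decidable using (⌊_⌋; toWitness; fromWitness)
open import Relation.Binary.PropositionalEquality using (_≡_; refl; sym; trans; cong; cong₂; subst)

is2 : Eps → Bool
is2 e1 = false
is2 e2 = true
is2 e3 = false

AgreeAt : Bool → Bool → Bool → Set
AgreeAt true  b c = b ≡ c
AgreeAt false _ _ = ⊤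

Agree : {n : ℕ} → Vec Bool n → Vec Bool n → Vec Bool n → Set
Agree []      []      []       = ⊤
Agree (f ∷ m) (b ∷ y) (c ∷ y′) = AgreeAt f b c × Agree m y y′

unmarked : {n : ℕ} → Vec Bool n → ℕ
unmarked []          = 0
unmarked (true ∷ m)  = unmarked m
unmarked (false ∷ m) = suc (unmarked m)

count2+unmarked≡length : {n : ℕ} (ε : Vec Eps n) → count2 ε + unmarked (map is2 ε) ≡ n
count2+unmarked≡length []       = refl
count2+unmarked≡length (e1 ∷ ε) = trans (+-suc (count2 ε) _) (cong suc (count2+unmarked≡length ε))
count2+unmarked≡length (e2 ∷ ε) = cong suc (count2+unmarked≡length ε)
count2+unmarked≡length (e3 ∷ ε) = trans (+-suc (count2 ε) _) (cong suc (count2+unmarked≡length ε))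

slices-meet : ∀ e b c → AgreeAt (is2 e) b c → ∃ λ a → p e a ≡ c × p e2 a ≡ b
slices-meet e1 false false _    = f0 , refl , refl
slices-meet e1 false true  _    = fs (fs f0) , refl , refl
slices-meet e1 true  false _    = fs f0 , refl , refl
slices-meet e1 true  true  _    = fs (fs (fs f0)) , refl , refl
slices-meet e2 false .false refl = f0 , refl , refl
slices-meet e2 true  .true  refl = fs f0 , refl , refl
slices-meet e3 false false _    = f0 , refl , refl
slices-meet e3 false true  _    = fs (fs f0) , refl , refl
slices-meet e3 true  false _    = fs (fs (fs f0)) , refl , refl
slices-meet e3 true  true  _    = fs f0 , refl , refl

agreeAt-slices : ∀ e a → AgreeAt (is2 e) (p e2 a) (p e a)
agreeAt-slices e1 _ = tt
agreeAt-slices e2 _ = refl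
agreeAt-slices e3 _ = tt

agree-subcubes : {n : ℕ} (ε : Vec Eps n) (α : Index n) → Agree (map is2 ε) (map (p e2) α) (pvec ε α)
agree-subcubes []      []      = tt
agree-subcubes (e ∷ ε) (a ∷ α) = agreeAt-slices e a , agree-subcubes ε α

agree⇒subcubes-meet : {n : ℕ} (ε : Vec Eps n) (y y′ : Vec Bool n) →
                      Agree (map is2 ε) y y′ → ∃ λ α → InC′ ε y′ α × InC y α
agree⇒subcubes-meet []      []      []       tt         = [] , refl , refl
agree⇒subcubes-meet (e ∷ ε) (b ∷ y) (c ∷ y′) (ag , ags) with slices-meet e b c ag | agree⇒subcubes-meet ε y y′ ags
... | a , pa , p2a | α , pα , p2α = a ∷ α , cong₂ _∷_ pa pα , cong₂ _∷_ p2a p2α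

subcubes-meet⇔agree : {n : ℕ} (ε : Vec Eps n) (y y′ : Vec Bool n) →
                      (∃ λ α → InC′ ε y′ α × InC y α) ⇔ Agree (map is2 ε) y y′
subcubes-meet⇔agree ε y y′ = mk⇔ (λ { (α , refl , refl) → agree-subcubes ε α }) (agree⇒subcubes-meet ε y y′)

xor-involutive : ∀ c a → c xor (c xor a) ≡ a
xor-involutive c a = trans (sym (xor-assoc c c a)) (cong (_xor a) (xor-same c))

parity-∷ : ∀ {n} c (y : Vec Bool n) s → parity y ≡ c xor s → parity (c ∷ y) ≡ s
parity-∷ c y s h = trans (cong (c xor_) h) (xor-involutive c s)

parity-tail : ∀ {n} c (y : Vec Bool n) s → parity (c ∷ y) ≡ s → parity y ≡ c xor s
parity-tail c y s h = trans (sym (xor-involutive c (parity y))) (cong (c xor_) h)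

bothHeads : {n : ℕ} → (Bool → List (Vec Bool n)) → List (Vec Bool (suc n))
bothHeads L = mapL (false ∷_) (L false) ++ mapL (true ∷_) (L true)

∈-map-∷⁻ : ∀ {n b c} {y : Vec Bool n} {L : List (Vec Bool n)} → (c ∷ y) ∈ mapL (b ∷_) L → c ≡ b × y ∈ L
∈-map-∷⁻ mem with ∈-map⁻ _ mem
... | _ , y∈L , eq = ∷-injectiveˡ eq , subst (_∈ _) (sym (∷-injectiveʳ eq)) y∈L

∈-bothHeads⁻ : ∀ {n} c {y : Vec Bool n} (L : Bool → List (Vec Bool n)) → (c ∷ y) ∈ bothHeads L → y ∈ L c
∈-bothHeads⁻ c L mem with c | ∈-++⁻ (mapL (false ∷_) (L false)) mem
... | false | inj₁ mem₀ = proj₂ (∈-map-∷⁻ mem₀)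
... | false | inj₂ mem₁ with () ← proj₁ (∈-map-∷⁻ mem₁)
... | true  | inj₁ mem₀ with () ← proj₁ (∈-map-∷⁻ mem₀)
... | true  | inj₂ mem₁ = proj₂ (∈-map-∷⁻ mem₁)

∈-bothHeads⁺ : ∀ {n} c {y : Vec Bool n} (L : Bool → List (Vec Bool n)) → y ∈ L c → (c ∷ y) ∈ bothHeads L
∈-bothHeads⁺ false L mem = ∈-++⁺ˡ (∈-map⁺ (false ∷_) mem)
∈-bothHeads⁺ true  L mem = ∈-++⁺ʳ _ (∈-map⁺ (true ∷_) mem)

bothHeads-unique : ∀ {n} (L : Bool → List (Vec Bool n)) → Unique (L false) → Unique (L true) → Unique (bothHeads L)
bothHeads-unique L u₀ u₁ = Unique.++⁺ (Unique.map⁺ ∷-injectiveʳ u₀) (Unique.map⁺ ∷-injectiveʳ u₁) heads-disjoint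
  where
  heads-disjoint : Disjoint (mapL (false ∷_) (L false)) (mapL (true ∷_) (L true))
  heads-disjoint (mem₀ , mem₁) with ∈-map⁻ _ mem₀ | ∈-map⁻ _ mem₁
  ... | _ , _ , refl | _ , _ , ()

length-bothHeads : ∀ {n} (L : Bool → List (Vec Bool n)) → length (bothHeads L) ≡ length (L false) + length (L true)
length-bothHeads L = trans (length-++ (mapL (false ∷_) (L false))) (cong₂ _+_ (length-map _ (L false)) (length-map _ (L true)))

agreeing : {n : ℕ} → Vec Bool n → Vec Bool n → Bool → List (Vec Bool n)
agreeing []          []      false = [ [] ]
agreeing []          []      true  = []
agreeing (true ∷ m)  (b ∷ y) s     = mapL (b ∷_) (agreeing m y (b xor s))
agreeing (false ∷ m) (_ ∷ y) s     = bothHeads λ c → agreeing m y (c xor s)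

∈-agreeing⁻ : {n : ℕ} (m y : Vec Bool n) (s : Bool) (y′ : Vec Bool n) →
              y′ ∈ agreeing m y s → parity y′ ≡ s × Agree m y y′
∈-agreeing⁻ []          []      false []       _   = refl , tt
∈-agreeing⁻ (true ∷ m)  (b ∷ y) s     (c ∷ y′) mem with ∈-map-∷⁻ mem
... | refl , mem′ with ∈-agreeing⁻ m y (b xor s) y′ mem′
...   | ps , ag = parity-∷ b y′ s ps , refl , ag
∈-agreeing⁻ (false ∷ m) (_ ∷ y) s     (c ∷ y′) mem
  with ∈-agreeing⁻ m y (c xor s) y′ (∈-bothHeads⁻ c (λ c′ → agreeing m y (c′ xor s)) mem)
... | ps , ag = parity-∷ c y′ s ps , tt , ag

∈-agreeing⁺ : {n : ℕ} (m y : Vec Bool n) (s : Bool) (y′ : Vec Bool n) →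
              parity y′ ≡ s → Agree m y y′ → y′ ∈ agreeing m y s
∈-agreeing⁺ []          []      .false []        refl tt         = here refl
∈-agreeing⁺ (true ∷ m)  (b ∷ y) s      (.b ∷ y′) ps   (refl , ag) =
  ∈-map⁺ (b ∷_) (∈-agreeing⁺ m y (b xor s) y′ (parity-tail b y′ s ps) ag)
∈-agreeing⁺ (false ∷ m) (_ ∷ y) s      (c ∷ y′)  ps   (_ , ag)    =
  ∈-bothHeads⁺ c (λ c′ → agreeing m y (c′ xor s)) (∈-agreeing⁺ m y (c xor s) y′ (parity-tail c y′ s ps) ag)

∈-agreeing⇔meet : {n : ℕ} (ε : Vec Eps n) (y : Vec Bool n) (s : Bool) (y′ : Vec Bool n) →
                  (y′ ∈ agreeing (map is2 ε) y s) ⇔ ((parity y′ ≡ s) × ∃ λ α → InC′ ε y′ α × InC y α)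
∈-agreeing⇔meet ε y s y′ = mk⇔
  (λ mem → let ps , ag = ∈-agreeing⁻ (map is2 ε) y s y′ mem in ps , from ag)
  (λ { (ps , meet) → ∈-agreeing⁺ (map is2 ε) y s y′ ps (to meet) })
  where open Equivalence (subcubes-meet⇔agree ε y y′)

agreeing-unique : {n : ℕ} (m y : Vec Bool n) (s : Bool) → Unique (agreeing m y s)
agreeing-unique []          []      false = All.[] AllPairs.∷ AllPairs.[]
agreeing-unique []          []      true  = AllPairs.[]
agreeing-unique (true ∷ m)  (b ∷ y) s     = Unique.map⁺ ∷-injectiveʳ (agreeing-unique m y (b xor s))
agreeing-unique (false ∷ m) (_ ∷ y) s     =
  bothHeads-unique (λ c → agreeing m y (c xor s)) (agreeing-unique m y (false xor s)) (agreeing-unique m y (true xor s))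

length-agreeing-unmarked : {n : ℕ} (m y : Vec Bool n) (b s : Bool) →
  length (agreeing (false ∷ m) (b ∷ y) s) ≡ length (agreeing m y false) + length (agreeing m y true)
length-agreeing-unmarked m y _ false = length-bothHeads (agreeing m y)
length-agreeing-unmarked m y _ true  =
  trans (length-bothHeads (λ c → agreeing m y (c xor true))) (+-comm (length (agreeing m y true)) _)

length-agreeing-both : {n : ℕ} (m y : Vec Bool n) →
                       length (agreeing m y false) + length (agreeing m y true) ≡ 2 ^ unmarked m
length-agreeing-both []          []          = refl
length-agreeing-both (true ∷ m)  (false ∷ y) =
  trans (cong₂ _+_ (length-map _ (agreeing m y false)) (length-map _ (agreeing m y true)))
        (length-agreeing-both m y)
length-agreeing-both (true ∷ m)  (true ∷ y)  =
  trans (cong₂ _+_ (length-map _ (agreeing m y true)) (length-map _ (agreeing m y false)))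
        (trans (+-comm (length (agreeing m y true)) _) (length-agreeing-both m y))
length-agreeing-both (false ∷ m) (b ∷ y)     =
  trans (cong₂ _+_ (length-agreeing-unmarked m y b false) (length-agreeing-unmarked m y b true))
        (cong₂ _+_ (length-agreeing-both m y) (trans (length-agreeing-both m y) (sym (+-identityʳ _))))

length-agreeing : {n u : ℕ} (m y : Vec Bool n) (s : Bool) → unmarked m ≡ suc u → length (agreeing m y s) ≡ 2 ^ u
length-agreeing (true ∷ m)  (b ∷ y) s h = trans (length-map _ (agreeing m y (b xor s))) (length-agreeing m y (b xor s) h)
length-agreeing (false ∷ m) (b ∷ y) s h =
  trans (length-agreeing-unmarked m y b s) (trans (length-agreeing-both m y) (cong (2 ^_) (suc-injective h)))

unmarked-count2< : {d : ℕ} (ε : Vec Eps d) → count2 ε < d → unmarked (map is2 ε) ≡ suc (pred (d ∸ count2 ε))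
unmarked-count2< {d} ε k<d = trans unmarked≡ (sym (suc-pred (d ∸ count2 ε) {{>-nonZero (m<n⇒0<n∸m k<d)}}))
  where
  unmarked≡ : unmarked (map is2 ε) ≡ d ∸ count2 ε
  unmarked≡ = trans (sym (m+n∸m≡n (count2 ε) _)) (cong (_∸ count2 ε) (count2+unmarked≡length ε))

cell : Eps → Bool → Bool → Subset 4
cell e b c = tabulate λ a → ⌊ p e a ≟ᵇ c ⌋ ∧ ⌊ p e2 a ≟ᵇ b ⌋

∈-cell⇔ : ∀ e b c a → (a ∈ₛ cell e b c) ⇔ ((p e a ≡ c) × (p e2 a ≡ b))
∈-cell⇔ e b c a = mk⇔
  (λ mem → let t₁ , t₂ = Equivalence.to (T-∧ {⌊ p? ⌋} {⌊ p2? ⌋})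
                                      (Equivalence.from T-≡ (trans (sym lookup-cell) ([]=⇒lookup mem)))
           in toWitness {a? = p?} t₁ , toWitness {a? = p2?} t₂)
  (λ { (pa , p2a) → lookup⇒[]= a (cell e b c) (trans lookup-cell
         (Equivalence.to T-≡ (Equivalence.from (T-∧ {⌊ p? ⌋} {⌊ p2? ⌋}) (fromWitness pa , fromWitness p2a)))) })
  where
  p? : Dec (p e a ≡ c)
  p? = p e a ≟ᵇ c
  p2? : Dec (p e2 a ≡ b)
  p2? = p e2 a ≟ᵇ b
  lookup-cell : lookup (cell e b c) a ≡ ⌊ p? ⌋ ∧ ⌊ p2? ⌋
  lookup-cell = lookup∘tabulate (λ a′ → ⌊ p e a′ ≟ᵇ c ⌋ ∧ ⌊ p e2 a′ ≟ᵇ b ⌋) a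

∣cell∣ : ∀ e b c → AgreeAt (is2 e) b c → ∣ cell e b c ∣ ≡ (if is2 e then 2 else 1)
∣cell∣ e1 false false _    = refl
∣cell∣ e1 false true  _    = refl
∣cell∣ e1 true  false _    = refl
∣cell∣ e1 true  true  _    = refl
∣cell∣ e2 false .false refl = refl
∣cell∣ e2 true  .true  refl = refl
∣cell∣ e3 false false _    = refl
∣cell∣ e3 false true  _    = refl
∣cell∣ e3 true  false _    = refl
∣cell∣ e3 true  true  _    = refl

cells : {n : ℕ} → Vec Eps n → Vec Bool n → Vec Bool n → Vec (Subset 4) n
cells []      []      []       = []
cells (e ∷ ε) (b ∷ y) (c ∷ y′) = cell e b c ∷ cells ε y y′

∈-cells⁺ : {n : ℕ} (ε : Vec Eps n) (y y′ : Vec Bool n) (α : Index n) →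
           InC′ ε y′ α × InC y α → ∀ i → lookup α i ∈ₛ lookup (cells ε y y′) i
∈-cells⁺ (e ∷ ε) (b ∷ y) (c ∷ y′) (a ∷ α) (inC′ , inC) f0     =
  Equivalence.from (∈-cell⇔ e b c a) (∷-injectiveˡ inC′ , ∷-injectiveˡ inC)
∈-cells⁺ (e ∷ ε) (b ∷ y) (c ∷ y′) (a ∷ α) (inC′ , inC) (fs i) =
  ∈-cells⁺ ε y y′ α (∷-injectiveʳ inC′ , ∷-injectiveʳ inC) i

∈-cells⁻ : {n : ℕ} (ε : Vec Eps n) (y y′ : Vec Bool n) (α : Index n) →
           (∀ i → lookup α i ∈ₛ lookup (cells ε y y′) i) → InC′ ε y′ α × InC y α
∈-cells⁻ []      []      []       []      _   = refl , refl
∈-cells⁻ (e ∷ ε) (b ∷ y) (c ∷ y′) (a ∷ α) mem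
  with Equivalence.to (∈-cell⇔ e b c a) (mem f0) | ∈-cells⁻ ε y y′ α (λ i → mem (fs i))
... | pa , p2a | inC′ , inC = cong₂ _∷_ pa inC′ , cong₂ _∷_ p2a inC

cells-size : {n : ℕ} (ε : Vec Eps n) (y y′ : Vec Bool n) → Agree (map is2 ε) y y′ →
             ∀ i → (∣ lookup (cells ε y y′) i ∣ ≡ 1) ⊎ (∣ lookup (cells ε y y′) i ∣ ≡ 2)
cells-size (e ∷ ε) (b ∷ y) (c ∷ y′) (ag , _)  f0     = one-or-two (is2 e) (∣cell∣ e b c ag)
  where
  one-or-two : ∀ f {x} → x ≡ (if f then 2 else 1) → (x ≡ 1) ⊎ (x ≡ 2)
  one-or-two false = inj₁
  one-or-two true  = inj₂
cells-size (_ ∷ ε) (_ ∷ y) (_ ∷ y′) (_ , ags) (fs i) = cells-size ε y y′ ags i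

countSize2-∷-2 : {n : ℕ} (T : Subset 4) (Ts : Vec (Subset 4) n) → ∣ T ∣ ≡ 2 → countSize2 (T ∷ Ts) ≡ suc (countSize2 Ts)
countSize2-∷-2 _ _ h rewrite h = refl

countSize2-∷-1 : {n : ℕ} (T : Subset 4) (Ts : Vec (Subset 4) n) → ∣ T ∣ ≡ 1 → countSize2 (T ∷ Ts) ≡ countSize2 Ts
countSize2-∷-1 _ _ h rewrite h = refl

countSize2-cells : {n : ℕ} (ε : Vec Eps n) (y y′ : Vec Bool n) → Agree (map is2 ε) y y′ →
                   countSize2 (cells ε y y′) ≡ count2 ε
countSize2-cells []       []      []       tt         = refl
countSize2-cells (e1 ∷ ε) (b ∷ y) (c ∷ y′) (ag , ags) =
  trans (countSize2-∷-1 (cell e1 b c) (cells ε y y′) (∣cell∣ e1 b c ag)) (countSize2-cells ε y y′ ags)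
countSize2-cells (e2 ∷ ε) (b ∷ y) (c ∷ y′) (ag , ags) =
  trans (countSize2-∷-2 (cell e2 b c) (cells ε y y′) (∣cell∣ e2 b c ag)) (cong suc (countSize2-cells ε y y′ ags))
countSize2-cells (e3 ∷ ε) (b ∷ y) (c ∷ y′) (ag , ags) =
  trans (countSize2-∷-1 (cell e3 b c) (cells ε y y′) (∣cell∣ e3 b c ag)) (countSize2-cells ε y y′ ags)

intersection-isSubmatrix2 : {n : ℕ} (ε : Vec Eps n) (y y′ : Vec Bool n) → Agree (map is2 ε) y y′ →
                            IsSubmatrix2 (count2 ε) (λ α → InC′ ε y′ α × InC y α)
intersection-isSubmatrix2 ε y y′ ag =
  cells ε y y′ , cells-size ε y y′ ag , countSize2-cells ε y y′ ag ,
  λ α → mk⇔ (∈-cells⁺ ε y y′ α) (∈-cells⁻ ε y y′ α)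

pvec-all2 : {n : ℕ} (ε : Vec Eps n) → count2 ε ≡ n → ∀ α → pvec ε α ≡ map (p e2) α
pvec-all2 []       _ []      = refl
pvec-all2 (e1 ∷ ε) h _       = ⊥-elim (m+1+n≢m (count2 ε) (trans (count2+unmarked≡length (e1 ∷ ε)) (sym h)))
pvec-all2 (e2 ∷ ε) h (a ∷ α) = cong (p e2 a ∷_) (pvec-all2 ε (suc-injective h) α)
pvec-all2 (e3 ∷ ε) h _       = ⊥-elim (m+1+n≢m (count2 ε) (trans (count2+unmarked≡length (e3 ∷ ε)) (sym h)))

subcubes-all2 : {n : ℕ} (ε : Vec Eps n) → count2 ε ≡ n → ∀ y α → InC′ ε y α ⇔ InC y α
subcubes-all2 ε h y α = mk⇔ (trans (sym (pvec-all2 ε h α))) (trans (pvec-all2 ε h α))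

subcubes-all2-disjoint : {n : ℕ} (ε : Vec Eps n) → count2 ε ≡ n →
                         ∀ y y′ {b b′} → parity y ≡ b → parity y′ ≡ b′ → ¬ b ≡ b′ → ∀ α → ¬ (InC′ ε y α × InC y′ α)
subcubes-all2-disjoint ε h y y′ py py′ b≢b′ α (inC′ , inC)
  with trans (sym (Equivalence.to (subcubes-all2 ε h y α) inC′)) inC
... | refl = b≢b′ (trans (sym py) py′)

proposition7 : (d : ℕ) (A : Matrix d) (ε : Vec Eps d) (lam : Vec Bool d → Bool) (s : Bool) (k : ℕ)
    → IsBlockPerm A ε lam s
    → Equivalent A (M4 d)
    → count2 ε ≡ k
    → ((k < d) → ∀ (y : Vec Bool d) → parity y ≡ false →
          Σ (List (Vec Bool d)) λ L →
            Unique L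
            × (length L ≡ 2 ^ (d ∸ k ∸ 1))
            × (∀ (y′ : Vec Bool d) → (y′ ∈ L) ⇔ ((parity y′ ≡ s) × ∃ λ α → InC′ ε y′ α × InC y α))
            × (∀ (y′ : Vec Bool d) → y′ ∈ L → IsSubmatrix2 k (λ α → InC′ ε y′ α × InC y α)))
      × ((k ≡ d) → s ≡ false →
          (∀ (y : Vec Bool d) → parity y ≡ false →
             Σ (Vec Bool d) λ y′ → (parity y′ ≡ false) × (∀ α → InC′ ε y α ⇔ InC y′ α))
          × (∀ (y′ : Vec Bool d) → parity y′ ≡ false →
             Σ (Vec Bool d) λ y → (parity y ≡ false) × (∀ α → InC′ ε y α ⇔ InC y′ α)))
      × ((k ≡ d) → s ≡ true →
          ∀ (y y′ : Vec Bool d) → parity y ≡ true → parity y′ ≡ false →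
            ∀ α → ¬ (InC′ ε y α × InC y′ α))
proposition7 d _ ε _ s _ _ _ refl =
    (λ k<d y _ →
       agreeing mask y s , agreeing-unique mask y s , length-agreeing mask y s (unmarked-count2< ε k<d) ,
       ∈-agreeing⇔meet ε y s ,
       λ y′ mem → intersection-isSubmatrix2 ε y y′ (proj₂ (∈-agreeing⁻ mask y s y′ mem)))
  , (λ k≡d _ → (λ y py → y , py , subcubes-all2 ε k≡d y) , (λ y py → y , py , subcubes-all2 ε k≡d y))
  , λ k≡d _ y y′ py py′ → subcubes-all2-disjoint ε k≡d y y′ py py′ λ ()
  where
  mask : Vec Bool d
  mask = map is2 ε
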